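{- Let $k\geq 1$ and $0\leq d\leq d'$ be integers. Let $L$ be a $k$-list-assignment of a graph $G$. Let $A,B$ be a partition of $V(G)$, where $G[A]$ is $L$-colourable with defect $d'$. If for every vertex $v\in B$, $(d+1)\deg_A(v) + \deg_B(v)+1 \leq (d+1)k$, then $G$ is $L$-colourable with defect $d'$.
   Context: Graphs are finite and simple. For $S\subseteq V(G)$ and $v\in V(G)$, $\deg_S(v)$ is the number of neighbours of $v$ in $S$. In a coloured graph the monochromatic subgraph is the spanning subgraph of edges whose endpoints have the same colour. A colouring has defect $d$ if the monochromatic subgraph has maximum degree at most $d$. A $k$-list-assignment $L$ assigns to each vertex $v$ a set $L(v)$ of at least $k$ colours; an $L$-colouring colours each $v$ with a colour from $L(v)$; a graph is $L$-colourable with defect $d$ if it has an $L$-colouring with defect $d$ (for $G[A]$, the restriction of $L$ to $A$ is used). -}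

module Defs where

open import Data.Nat using (ℕ; zero; suc; _≤_; _≟_)
open import Data.Bool using (Bool; true; false; _∧_)
open import Data.Fin using (Fin)
open import Data.List using (List; length; filterᵇ; allFin)
open import Data.List.Relation.Unary.Unique.Propositional using (Unique)
open import Data.List.Membership.Propositional using (_∈_)
open import Relation.Binary.PropositionalEquality using (_≡_)
open import Relation.Nullary using (¬_)
open import Relation.Nullary.Decidable using (⌊_⌋)
open import Data.Product using (_×_; Σ)

record Graph (n : ℕ) : Set where
  field
    adj   : Fin n → Fin n → Bool
    sym   : ∀ u v → adj u v ≡ adj v u
    irrefl : ∀ v → adj v v ≡ false
open Graph public

VSet : ℕ → Set
VSet n = Fin n → Bool

-- complement (for the partition A, B: B = complement of A)
compl : ∀ {n} → VSet n → VSet n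
compl S v with S v
... | true = false
... | false = true

deg : ∀ {n} → Graph n → VSet n → Fin n → ℕ
deg G S v = length (filterᵇ (λ u → S u ∧ adj G v u) (allFin _))

Colouring : ℕ → Set
Colouring n = Fin n → ℕ

monoDeg : ∀ {n} → Graph n → VSet n → Colouring n → Fin n → ℕ
monoDeg G S c v =
  length (filterᵇ (λ u → S u ∧ (adj G v u ∧ ⌊ c u ≟ c v ⌋)) (allFin _))

ListAssignment : ℕ → Set
ListAssignment n = Fin n → List ℕ

IsKListAssignment : ∀ {n} → ℕ → ListAssignment n → Set
IsKListAssignment k L = ∀ v → Unique (L v) × (k ≤ length (L v))

-- G[S] is L-colourable with defect d: there is an L-colouring of G[S] (only the
-- values on S matter) whose monochromatic subgraph in G[S] has max degree ≤ d.
IsLColouringWithDefectOn : ∀ {n} → Graph n → VSet n → ListAssignment n → ℕ → Colouring n → Set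
IsLColouringWithDefectOn G S L d c =
  ∀ v → S v ≡ true → (c v ∈ L v) × (monoDeg G S c v ≤ d)

LColourableWithDefectOn : ∀ {n} → Graph n → VSet n → ListAssignment n → ℕ → Set
LColourableWithDefectOn {n} G S L d = Σ (Colouring n) (IsLColouringWithDefectOn G S L d)

everything : ∀ {n} → VSet n
everything _ = true

LColourableWithDefect : ∀ {n} → Graph n → ListAssignment n → ℕ → Set
LColourableWithDefect G L d = LColourableWithDefectOn G everything L d

-- Colour A as given and B arbitrarily from its lists, then repeatedly recolour
-- a vertex of B that has too many conflicts.  A monochromatic edge weighs 0
-- inside A, 1 inside B and d + 1 between A and B; a vertex v of B is settled
-- when the total weight of its monochromatic edges is at most d.  Summed over
-- the colours of L(v), these weights are at most (d + 1) deg_A(v) + deg_B(v),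
-- which by hypothesis is less than (d + 1) |L(v)|, so some colour of L(v) is
-- acceptable.  Moving v to it strictly lowers the total weight of monochromatic
-- edges, so the process stops.  At the end no vertex of B has a monochromatic
-- neighbour in A, hence vertices of A keep their defect from G[A], and vertices
-- of B have defect at most d ≤ d'.
module Submission where

open import Defs hiding (sym)
open import Data.Bool as Bool using (Bool; true; false; _∧_; not; if_then_else_)
open import Data.Fin using (Fin; zero; suc; punchIn; fromℕ<)
open import Data.Fin.Properties using (punchInᵢ≢i; any?) renaming (_≟_ to _≟ᶠ_)
open import Data.List using (List; []; _∷_; length; lookup; filterᵇ; tabulate)
open import Data.List.Membership.Propositional using (_∈_)
open import Data.List.Membership.Propositional.Properties using (∈-lookup)
open import Data.List.Relation.Unary.All using (All; []; _∷_)
open import Data.List.Relation.Unary.AllPairs using ([]; _∷_)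
open import Data.List.Relation.Unary.Unique.Propositional using (Unique)
open import Data.Nat using (ℕ; zero; suc; _≤_; _<_; _+_; _*_; z≤n; _≟_; _<?_; s≤s⁻¹)
open import Data.Nat.Induction using (<-wellFounded)
open import Data.Nat.Properties hiding (_≟_)
open import Data.Nat.Tactic.RingSolver using (solve-∀)
open import Data.Product using (∃; _,_; _×_; proj₁; proj₂)
open import Data.Vec.Functional using (removeAt; updateAt)
open import Data.Vec.Functional.Properties using (updateAt-updates; updateAt-minimal)
open import Function using (_∘_; const)
open import Induction.WellFounded using (Acc; acc)
open import Relation.Binary.PropositionalEquality
open import Relation.Nullary using (yes; no; contradiction)
open import Relation.Nullary.Decidable using (⌊_⌋; _×-dec_)
open import Algebra.Properties.Semiring.Sum +-*-semiring
  using (sum; sum-syntax; sum-cong-≗; sum-remove; ∑-distrib-+; ∑-comm; *-distribˡ-sum)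

χ : Bool → ℕ
χ true  = 1
χ false = 0

sum-mono-≤ : ∀ {n} {f g : Fin n → ℕ} → (∀ i → f i ≤ g i) → sum f ≤ sum g
sum-mono-≤ {zero}  f≤g = z≤n
sum-mono-≤ {suc n} f≤g = +-mono-≤ (f≤g zero) (sum-mono-≤ (f≤g ∘ suc))

≤-∑ : ∀ {n} (f : Fin n → ℕ) i → f i ≤ sum f
≤-∑ f zero    = m≤m+n (f zero) _
≤-∑ f (suc i) = ≤-trans (≤-∑ (f ∘ suc) i) (m≤n+m _ (f zero))

∑-below-average : ∀ {n} (g : Fin n → ℕ) m → sum g < n * m → ∃ λ i → g i < m
∑-below-average {suc n} g m ∑g<[1+n]m with g zero <? m
... | yes g₀<m = zero , g₀<m
... | no g₀≮m
  with ∑-below-average (g ∘ suc) m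
         (+-cancelˡ-< m _ _ (≤-<-trans (+-monoˡ-≤ _ (≮⇒≥ g₀≮m)) ∑g<[1+n]m))
...   | i , gᵢ<m = suc i , gᵢ<m

length-filterᵇ-tabulate : ∀ {a} {X : Set a} {n} (p : X → Bool) (f : Fin n → X) →
  length (filterᵇ p (tabulate f)) ≡ ∑[ i < n ] χ (p (f i))
length-filterᵇ-tabulate {n = zero}  p f = refl
length-filterᵇ-tabulate {n = suc n} p f with p (f zero)
... | true  = cong suc (length-filterᵇ-tabulate p (f ∘ suc))
... | false = length-filterᵇ-tabulate p (f ∘ suc)

∑² : ∀ {n} → (Fin n → Fin n → ℕ) → ℕ
∑² {n} f = ∑[ u < n ] sum (f u)

IsSymmetric : ∀ {n} → (Fin n → Fin n → ℕ) → Set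
IsSymmetric f = ∀ u w → f u w ≡ f w u

∑²-remove : ∀ {n} (f : Fin (suc n) → Fin (suc n) → ℕ) → IsSymmetric f → ∀ v →
  ∑² f + f v v ≡ (sum (f v) + sum (f v)) + ∑² (λ i j → f (punchIn v i) (punchIn v j))
∑²-remove {n} f f-sym v = begin
  ∑² f + f v v
    ≡⟨ cong (_+ f v v) (sum-cong-≗ (λ u → sum-remove {i = v} (f u))) ⟩
  ∑[ u < suc n ] (f u v + row′ u) + f v v
    ≡⟨ cong (_+ f v v) (∑-distrib-+ (λ u → f u v) row′) ⟩
  (sum (λ u → f u v) + sum row′) + f v v
    ≡⟨ cong (λ x → (sum (λ u → f u v) + x) + f v v) (sum-remove {i = v} row′) ⟩
  (sum (λ u → f u v) + (row′ v + rest)) + f v v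
    ≡⟨ cong (λ x → (x + (row′ v + rest)) + f v v) (sum-cong-≗ (λ u → f-sym u v)) ⟩
  (sum (f v) + (row′ v + rest)) + f v v
    ≡⟨ rearrange (sum (f v)) (row′ v) rest (f v v) ⟩
  (sum (f v) + (f v v + row′ v)) + rest
    ≡⟨ cong (λ x → (sum (f v) + x) + rest) (sum-remove {i = v} (f v)) ⟨
  (sum (f v) + sum (f v)) + rest
    ∎
  where
  open ≡-Reasoning
  row′ : Fin (suc n) → ℕ
  row′ u = sum (removeAt (f u) v)
  rest : ℕ
  rest = ∑² (λ i j → f (punchIn v i) (punchIn v j))
  rearrange : ∀ s r q x → (s + (r + q)) + x ≡ (s + (x + r)) + q
  rearrange = solve-∀

∑²-update : ∀ {n} (f f′ : Fin n → Fin n → ℕ) → IsSymmetric f → IsSymmetric f′ → ∀ v →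
  (∀ u w → u ≢ v → w ≢ v → f′ u w ≡ f u w) → f′ v v ≡ f v v →
  ∑² f′ + (sum (f v) + sum (f v)) ≡ ∑² f + (sum (f′ v) + sum (f′ v))
∑²-update {suc n} f f′ f-sym f′-sym v agree diag = +-cancelʳ-≡ (f v v) _ _ (begin
  (∑² f′ + (r + r)) + f v v    ≡⟨ cong (λ x → (∑² f′ + (r + r)) + x) diag ⟨
  (∑² f′ + (r + r)) + f′ v v   ≡⟨ swap (∑² f′) (r + r) (f′ v v) ⟩
  (∑² f′ + f′ v v) + (r + r)   ≡⟨ cong (_+ (r + r)) (∑²-remove f′ f′-sym v) ⟩
  ((r′ + r′) + q′) + (r + r)   ≡⟨ cong (λ x → ((r′ + r′) + x) + (r + r)) q′≡q ⟩
  ((r′ + r′) + q) + (r + r)    ≡⟨ exchange (r′ + r′) q (r + r) ⟩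
  ((r + r) + q) + (r′ + r′)    ≡⟨ cong (_+ (r′ + r′)) (∑²-remove f f-sym v) ⟨
  (∑² f + f v v) + (r′ + r′)   ≡⟨ swap (∑² f) (r′ + r′) (f v v) ⟨
  (∑² f + (r′ + r′)) + f v v   ∎)
  where
  open ≡-Reasoning
  r r′ q q′ : ℕ
  r  = sum (f v)
  r′ = sum (f′ v)
  q  = ∑² (λ i j → f (punchIn v i) (punchIn v j))
  q′ = ∑² (λ i j → f′ (punchIn v i) (punchIn v j))
  q′≡q : q′ ≡ q
  q′≡q = sum-cong-≗ λ i → sum-cong-≗ λ j →
    agree (punchIn v i) (punchIn v j) (punchInᵢ≢i v i) (punchInᵢ≢i v j)
  swap : ∀ a b c → (a + b) + c ≡ (a + c) + b
  swap = solve-∀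
  exchange : ∀ a b c → (a + b) + c ≡ (c + b) + a
  exchange = solve-∀

⌊≟⌋-sym : ∀ x y → ⌊ x ≟ y ⌋ ≡ ⌊ y ≟ x ⌋
⌊≟⌋-sym x y with x ≟ y | y ≟ x
... | yes _   | yes _   = refl
... | no _    | no _    = refl
... | yes x≡y | no y≢x  = contradiction (sym x≡y) y≢x
... | no x≢y  | yes y≡x = contradiction (sym y≡x) x≢y

χ⌊≟⌋-≡ : ∀ {x y} → x ≡ y → χ ⌊ x ≟ y ⌋ ≡ 1
χ⌊≟⌋-≡ {x} {y} x≡y with x ≟ y
... | yes _   = refl
... | no x≢y = contradiction x≡y x≢y

occurrences : ℕ → List ℕ → ℕ
occurrences x xs = ∑[ j < length xs ] χ ⌊ x ≟ lookup xs j ⌋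

occurrences-absent : ∀ x xs → All (x ≢_) xs → occurrences x xs ≡ 0
occurrences-absent x []       []            = refl
occurrences-absent x (y ∷ ys) (x≢y ∷ x∉ys) with x ≟ y
... | yes x≡y = contradiction x≡y x≢y
... | no _    = occurrences-absent x ys x∉ys

occurrences-unique : ∀ x xs → Unique xs → occurrences x xs ≤ 1
occurrences-unique x []       []              = z≤n
occurrences-unique x (y ∷ ys) (y∉ys ∷ ys-uniq) with x ≟ y
... | yes refl = ≤-reflexive (cong suc (occurrences-absent x ys y∉ys))
... | no _     = occurrences-unique x ys ys-uniq

module Conflicts {n} (W : Fin n → Fin n → ℕ) (W-sym : IsSymmetric W) (W-diag : ∀ v → W v v ≡ 0) where

  conflict : Colouring n → Fin n → ℕ → ℕ
  conflict c v a = ∑[ w < n ] (W v w * χ ⌊ c w ≟ a ⌋)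

  monoWeight : Colouring n → Fin n → Fin n → ℕ
  monoWeight c u w = W u w * χ ⌊ c w ≟ c u ⌋

  energy : Colouring n → ℕ
  energy c = ∑² (monoWeight c)

  monoWeight-sym : ∀ c → IsSymmetric (monoWeight c)
  monoWeight-sym c u w = cong₂ _*_ (W-sym u w) (cong χ (⌊≟⌋-sym (c w) (c u)))

  recolour : Colouring n → Fin n → ℕ → Colouring n
  recolour c v a = updateAt c v (const a)

  conflict-recolour : ∀ c v a → conflict (recolour c v a) v (recolour c v a v) ≡ conflict c v a
  conflict-recolour c v a = sum-cong-≗ term
    where
    term : ∀ w → W v w * χ ⌊ recolour c v a w ≟ recolour c v a v ⌋ ≡ W v w * χ ⌊ c w ≟ a ⌋
    term w with w ≟ᶠ v
    ... | yes refl rewrite W-diag v = refl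
    ... | no w≢v
      rewrite updateAt-updates v {const a} c | updateAt-minimal w v {const a} c w≢v = refl

  energy-recolour : ∀ c v a →
    energy (recolour c v a) + (conflict c v (c v) + conflict c v (c v)) ≡
    energy c + (conflict c v a + conflict c v a)
  energy-recolour c v a =
    subst (λ x → energy c′ + _ ≡ energy c + (x + x)) (conflict-recolour c v a)
      (∑²-update (monoWeight c) (monoWeight c′) (monoWeight-sym c) (monoWeight-sym c′) v agree diag)
    where
    c′ : Colouring n
    c′ = recolour c v a
    agree : ∀ u w → u ≢ v → w ≢ v → monoWeight c′ u w ≡ monoWeight c u w
    agree u w u≢v w≢v
      rewrite updateAt-minimal u v {const a} c u≢v | updateAt-minimal w v {const a} c w≢v = refl
    diag : monoWeight c′ v v ≡ monoWeight c v v
    diag rewrite W-diag v = refl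

  energy-recolour-< : ∀ c v a → conflict c v a < conflict c v (c v) →
    energy (recolour c v a) < energy c
  energy-recolour-< c v a lt = +-cancelʳ-< (x + x) (energy (recolour c v a)) (energy c) (begin-strict
    energy (recolour c v a) + (x + x) ≡⟨ energy-recolour c v a ⟩
    energy c + (y + y)                <⟨ +-monoʳ-< (energy c) (+-mono-< lt lt) ⟩
    energy c + (x + x)                ∎)
    where
    open ≤-Reasoning
    x y : ℕ
    x = conflict c v (c v)
    y = conflict c v a

  ∑-conflict-≤ : ∀ c v xs → Unique xs → ∑[ j < length xs ] conflict c v (lookup xs j) ≤ sum (W v)
  ∑-conflict-≤ c v xs xs-uniq = begin
    ∑[ j < length xs ] ∑[ w < n ] (W v w * χ ⌊ c w ≟ lookup xs j ⌋)
      ≡⟨ ∑-comm (λ j w → W v w * χ ⌊ c w ≟ lookup xs j ⌋) ⟩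
    ∑[ w < n ] ∑[ j < length xs ] (W v w * χ ⌊ c w ≟ lookup xs j ⌋)
      ≡⟨ sum-cong-≗ (λ w → *-distribˡ-sum (W v w) (λ j → χ ⌊ c w ≟ lookup xs j ⌋)) ⟨
    ∑[ w < n ] (W v w * occurrences (c w) xs)
      ≤⟨ sum-mono-≤ (λ w → *-monoʳ-≤ (W v w) (occurrences-unique (c w) xs xs-uniq)) ⟩
    ∑[ w < n ] (W v w * 1)
      ≡⟨ sum-cong-≗ (λ w → *-identityʳ (W v w)) ⟩
    sum (W v)
      ∎
    where open ≤-Reasoning

compl-not : ∀ {n} (S : VSet n) u → compl S u ≡ not (S u)
compl-not S u with S u
... | true  = refl
... | false = refl

module _ {n} (G : Graph n) (A : VSet n) (d : ℕ) where

  sideWeight : Bool → Bool → ℕ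
  sideWeight true  true  = 0
  sideWeight false false = 1
  sideWeight _     _     = suc d

  sideWeight-sym : ∀ x y → sideWeight x y ≡ sideWeight y x
  sideWeight-sym true  true  = refl
  sideWeight-sym true  false = refl
  sideWeight-sym false true  = refl
  sideWeight-sym false false = refl

  weight : Fin n → Fin n → ℕ
  weight u w = if adj G u w then sideWeight (A u) (A w) else 0

  weight-sym : IsSymmetric weight
  weight-sym u w rewrite Graph.sym G u w | sideWeight-sym (A u) (A w) = refl

  weight-diag : ∀ v → weight v v ≡ 0
  weight-diag v rewrite Graph.irrefl G v = refl

  open Conflicts weight weight-sym weight-diag public

  deg-∑ : ∀ S v → deg G S v ≡ ∑[ u < n ] χ (S u ∧ adj G v u)
  deg-∑ S v = length-filterᵇ-tabulate (λ u → S u ∧ adj G v u) (λ u → u)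

  monoDeg-∑ : ∀ S c v → monoDeg G S c v ≡ ∑[ u < n ] χ (S u ∧ (adj G v u ∧ ⌊ c u ≟ c v ⌋))
  monoDeg-∑ S c v = length-filterᵇ-tabulate (λ u → S u ∧ (adj G v u ∧ ⌊ c u ≟ c v ⌋)) (λ u → u)

  ∑-weight : ∀ v → A v ≡ false → sum (weight v) ≡ suc d * deg G A v + deg G (compl A) v
  ∑-weight v Bv = begin
    sum (weight v)
      ≡⟨ sum-cong-≗ term ⟩
    ∑[ u < n ] (suc d * χ (A u ∧ adj G v u) + χ (compl A u ∧ adj G v u))
      ≡⟨ ∑-distrib-+ (λ u → suc d * χ (A u ∧ adj G v u)) (λ u → χ (compl A u ∧ adj G v u)) ⟩
    ∑[ u < n ] (suc d * χ (A u ∧ adj G v u)) + ∑[ u < n ] χ (compl A u ∧ adj G v u)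
      ≡⟨ cong (_+ _) (*-distribˡ-sum (suc d) (λ u → χ (A u ∧ adj G v u))) ⟨
    suc d * ∑[ u < n ] χ (A u ∧ adj G v u) + ∑[ u < n ] χ (compl A u ∧ adj G v u)
      ≡⟨ cong₂ (λ x y → suc d * x + y) (deg-∑ A v) (deg-∑ (compl A) v) ⟨
    suc d * deg G A v + deg G (compl A) v
      ∎
    where
    open ≡-Reasoning
    term : ∀ u → weight v u ≡ suc d * χ (A u ∧ adj G v u) + χ (compl A u ∧ adj G v u)
    term u rewrite Bv | compl-not A u with A u | adj G v u
    ... | true  | true  = sym (trans (+-identityʳ _) (*-identityʳ _))
    ... | true  | false = sym (trans (+-identityʳ _) (*-zeroʳ (suc d)))
    ... | false | true  = sym (cong (_+ 1) (*-zeroʳ d))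
    ... | false | false = sym (trans (+-identityʳ _) (*-zeroʳ d))

  good-colour : ∀ c v xs → A v ≡ false → Unique xs →
    suc d * deg G A v + deg G (compl A) v < suc d * length xs →
    ∃ λ a → a ∈ xs × conflict c v a ≤ d
  good-colour c v xs Bv xs-uniq room
    with ∑-below-average (λ j → conflict c v (lookup xs j)) (suc d) (begin-strict
      ∑[ j < length xs ] conflict c v (lookup xs j) ≤⟨ ∑-conflict-≤ c v xs xs-uniq ⟩
      sum (weight v)                                 ≡⟨ ∑-weight v Bv ⟩
      suc d * deg G A v + deg G (compl A) v          <⟨ room ⟩
      suc d * length xs                              ≡⟨ *-comm (suc d) (length xs) ⟩
      length xs * suc d                              ∎)
    where open ≤-Reasoning
  ... | j , conflict<1+d = lookup xs j , ∈-lookup j , s≤s⁻¹ conflict<1+d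

  monoDeg≤conflict : ∀ c v → A v ≡ false → monoDeg G everything c v ≤ conflict c v (c v)
  monoDeg≤conflict c v Bv = begin
    monoDeg G everything c v                 ≡⟨ monoDeg-∑ everything c v ⟩
    ∑[ u < n ] χ (adj G v u ∧ ⌊ c u ≟ c v ⌋) ≤⟨ sum-mono-≤ term ⟩
    conflict c v (c v)                       ∎
    where
    open ≤-Reasoning
    term : ∀ u → χ (adj G v u ∧ ⌊ c u ≟ c v ⌋) ≤ weight v u * χ ⌊ c u ≟ c v ⌋
    term u rewrite Bv with adj G v u | A u
    ... | false | _     = z≤n
    ... | true  | true  = m≤n*m _ (suc d)
    ... | true  | false = m≤n*m _ 1

  monochromatic-cross-edge : ∀ c u w → A u ≡ true → A w ≡ false → adj G w u ≡ true →
    c u ≡ c w → suc d ≤ conflict c w (c w)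
  monochromatic-cross-edge c u w Au Bw wu cu≡cw = begin
    suc d                          ≡⟨ *-identityʳ (suc d) ⟨
    suc d * 1                      ≡⟨ cong₂ _*_ weight-wu (χ⌊≟⌋-≡ cu≡cw) ⟨
    weight w u * χ ⌊ c u ≟ c w ⌋   ≤⟨ ≤-∑ (λ x → weight w x * χ ⌊ c x ≟ c w ⌋) u ⟩
    conflict c w (c w)             ∎
    where
    open ≤-Reasoning
    weight-wu : weight w u ≡ suc d
    weight-wu rewrite wu | Au | Bw = refl

  module _ (L : ListAssignment n) (cA : Colouring n) where

    Admissible : Colouring n → Set
    Admissible c = (∀ u → A u ≡ true → c u ≡ cA u) × (∀ u → A u ≡ false → c u ∈ L u)

    Settled : Colouring n → Set
    Settled c = ∀ v → A v ≡ false → conflict c v (c v) ≤ d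

    admissible-recolour : ∀ c v a → A v ≡ false → a ∈ L v → Admissible c →
      Admissible (recolour c v a)
    admissible-recolour c v a Bv a∈Lv (onA , onB) = onA′ , onB′
      where
      onA′ : ∀ u → A u ≡ true → recolour c v a u ≡ cA u
      onA′ u Au = trans (updateAt-minimal u v c λ { refl → contradiction (trans (sym Au) Bv) λ () })
                        (onA u Au)
      onB′ : ∀ u → A u ≡ false → recolour c v a u ∈ L u
      onB′ u Bu with u ≟ᶠ v
      ... | yes refl rewrite updateAt-updates v {const a} c = a∈Lv
      ... | no u≢v   rewrite updateAt-minimal u v {const a} c u≢v = onB u Bu

    local-search : (∀ c v → A v ≡ false → ∃ λ a → a ∈ L v × conflict c v a ≤ d) →
      ∀ c → Acc _<_ (energy c) → Admissible c → ∃ λ c → Admissible c × Settled c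
    local-search recolourable c (acc rec) adm
      with any? (λ v → (A v Bool.≟ false) ×-dec (d <? conflict c v (c v)))
    ... | no none = c , adm , λ v Bv → ≮⇒≥ (λ unsettled → none (v , Bv , unsettled))
    ... | yes (v , Bv , unsettled) with recolourable c v Bv
    ...   | a , a∈Lv , a-ok =
      local-search recolourable (recolour c v a)
        (rec (energy-recolour-< c v a (≤-<-trans a-ok unsettled)))
        (admissible-recolour c v a Bv a∈Lv adm)

    monoDeg≤monoDeg-cA : ∀ c → Admissible c → Settled c → ∀ v → A v ≡ true →
      monoDeg G everything c v ≤ monoDeg G A cA v
    monoDeg≤monoDeg-cA c (onA , _) settled v Av = begin
      monoDeg G everything c v                            ≡⟨ monoDeg-∑ everything c v ⟩
      ∑[ u < n ] χ (adj G v u ∧ ⌊ c u ≟ c v ⌋)            ≤⟨ sum-mono-≤ term ⟩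
      ∑[ u < n ] χ (A u ∧ (adj G v u ∧ ⌊ cA u ≟ cA v ⌋)) ≡⟨ monoDeg-∑ A cA v ⟨
      monoDeg G A cA v                                    ∎
      where
      open ≤-Reasoning
      term : ∀ u → χ (adj G v u ∧ ⌊ c u ≟ c v ⌋) ≤ χ (A u ∧ (adj G v u ∧ ⌊ cA u ≟ cA v ⌋))
      term u with A u in Au
      ... | true rewrite onA u Au | onA v Av = ≤-refl
      ... | false with adj G v u in vu | c u ≟ c v
      ...   | false | _         = z≤n
      ...   | true  | no _      = z≤n
      ...   | true  | yes cu≡cv = contradiction (settled u Au)
              (<⇒≱ (monochromatic-cross-edge c v u Av Au (trans (Graph.sym G u v) vu) (sym cu≡cv)))

    settled⇒defect : ∀ {d′} → d ≤ d′ → IsLColouringWithDefectOn G A L d′ cA →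
      ∀ c → Admissible c → Settled c → IsLColouringWithDefectOn G everything L d′ c
    settled⇒defect d≤d′ cA-ok c adm@(onA , onB) settled v _ with A v in Av
    ... | true  = subst (_∈ L v) (sym (onA v Av)) (proj₁ (cA-ok v Av)) ,
                  ≤-trans (monoDeg≤monoDeg-cA c adm settled v Av) (proj₂ (cA-ok v Av))
    ... | false = onB v Av , ≤-trans (monoDeg≤conflict c v Av) (≤-trans (settled v Av) d≤d′)

lemma13 : (n k d d' : ℕ) → 1 ≤ k → d ≤ d' →
    (G : Graph n) (L : ListAssignment n) → IsKListAssignment k L →
    (A : VSet n) →
    LColourableWithDefectOn G A L d' →
    (∀ v → A v ≡ false →
      (suc d) * deg G A v + deg G (compl A) v + 1 ≤ (suc d) * k) →
    LColourableWithDefect G L d'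
lemma13 n k d d' 1≤k d≤d' G L isK A (cA , cA-ok) hyp =
  let c , adm , settled = local-search G A d L cA recolourable c₀ (<-wellFounded _) c₀-admissible
  in c , settled⇒defect G A d L cA d≤d' cA-ok c adm settled
  where
  recolourable : ∀ c v → A v ≡ false → ∃ λ a → a ∈ L v × conflict G A d c v a ≤ d
  recolourable c v Bv = good-colour G A d c v (L v) Bv (proj₁ (isK v))
    (<-≤-trans (subst (_≤ suc d * k) (+-comm _ 1) (hyp v Bv)) (*-monoʳ-≤ (suc d) (proj₂ (isK v))))
  c₀ : Colouring n
  c₀ u = if A u then cA u else lookup (L u) (fromℕ< (≤-trans 1≤k (proj₂ (isK u))))
  c₀-admissible : Admissible G A d L cA c₀
  c₀-admissible = onA , onB
    where
    onA : ∀ u → A u ≡ true → c₀ u ≡ cA u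
    onA u Au rewrite Au = refl
    onB : ∀ u → A u ≡ false → c₀ u ∈ L u
    onB u Bu rewrite Bu = ∈-lookup _
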